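{- For any single-elimination tournament $\mathcal{T}$ and any two distinct players $a,b$, there exists a unique match $x_{a,b}$ having in-neighbours $u_a,u_b\in N^-(x_{a,b})$ satisfying $P(u_a)\cap\{a,b\}=\{a\}$ and $P(u_b)\cap\{a,b\}=\{b\}$.
   Context: For a digraph, $N^+(v)$ is the set of out-neighbours of $v$ and $N^-(v)$ the set of in-neighbours; a sink has $N^+(v)=\emptyset$, a source has $N^-(v)=\emptyset$. A single-elimination tournament $\mathcal{T}$ is a finite digraph with: exactly one sink; $|N^+(v)|=1$ for every non-sink $v$; no directed cycles; and $|N^-(v)|\ne 1$ for every vertex $v$. Players are the sources; matches are the non-sources. A directed walk from $u_1$ to $u_t$ is a sequence $(u_1,\dots,u_t)$, $t\ge1$, with $u_{i+1}\in N^+(u_i)$; the player set $P(u)$ of a vertex $u$ is the set of players $a$ with a directed walk from $a$ to $u$. -}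

module Defs where

open import Data.Nat using (ℕ)
open import Data.Fin using (Fin)
open import Data.Product using (Σ; _×_; ∃)
open import Relation.Nullary using (¬_)
open import Relation.Binary.PropositionalEquality using (_≡_)

record Digraph : Set₁ where
  field
    n : ℕ
    E : Fin n → Fin n → Set

module _ (G : Digraph) where
  open Digraph G

  Vertex : Set
  Vertex = Fin n

  Sink : Vertex → Set
  Sink v = ∀ w → ¬ E v w

  Source : Vertex → Set
  Source v = ∀ w → ¬ E w v

  OneOut : Vertex → Set
  OneOut v = Σ Vertex λ w → E v w × (∀ w' → E v w' → w' ≡ w)

  OneIn : Vertex → Set
  OneIn v = Σ Vertex λ u → E u v × (∀ u' → E u' v → u' ≡ u)

  data Walk : Vertex → Vertex → Set where
    here : ∀ {u} → Walk u u
    step : ∀ {u v w} → E u v → Walk v w → Walk u w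

  Acyclic : Set
  Acyclic = ∀ u v → E u v → ¬ Walk v u

  record IsSET : Set where
    field
      uniqueSink : Σ Vertex λ s → Sink s × (∀ t → Sink t → t ≡ s)
      outDeg     : ∀ v → ¬ Sink v → OneOut v
      acyclic    : Acyclic
      inDeg      : ∀ v → ¬ OneIn v

  Player : Vertex → Set
  Player = Source

  Match : Vertex → Set
  Match v = ¬ Source v

  -- a ∈ P(u): a is a player with a directed walk from a to u
  InP : Vertex → Vertex → Set
  InP a u = Player a × Walk a u

  -- x has in-neighbours u_a, u_b with P(u_a) ∩ {a,b} = {a} and P(u_b) ∩ {a,b} = {b}
  Separates : Vertex → Vertex → Vertex → Set
  Separates a b x =
    Σ Vertex λ ua → Σ Vertex λ ub →
      E ua x × E ub x ×
      (InP a ua × ¬ InP b ua) ×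
      (InP b ub × ¬ InP a ub)

{-# OPTIONS --safe #-}

-- Every non-sink has exactly one out-arc, so the walks leaving a vertex form a
-- single chain and any two vertices reachable from a common vertex are
-- comparable. The chain from a ends at the unique sink, which b also reaches;
-- the match x is where that chain first enters the descendants of b. Its
-- predecessor u_a on the chain is not reached by b, and its predecessor u_b on a
-- walk from b is not reached by a, for otherwise the chain from a would pass
-- through x and come back to it. Conversely, every common descendant of a and b
-- is reachable from any separating match, so two separating matches reach each
-- other and coincide by acyclicity. Iterating the out-neighbour map n times
-- reaches the sink (pigeonhole plus acyclicity); this bounds the search along a
-- chain and makes reachability decidable.

module Submission where

open import Defs
open import Data.Empty using (⊥-elim)
open import Data.Fin using (toℕ; fromℕ; fromℕ<)
open import Data.Fin.Properties using (_≟_; any?; pigeonhole; toℕ≤pred[n]; toℕ-fromℕ; toℕ-fromℕ<)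
open import Data.Nat using (ℕ; zero; suc; _+_; _≤_; _<_; _∸_; _≤?_; s≤s)
open import Data.Nat.GeneralisedArithmetic using (fold; fold-+)
open import Data.Nat.Properties using (n<1+n; m∸n+n≡m; ≰⇒≥)
open import Data.Product using (Σ; _×_; _,_; proj₁; proj₂; ∃-syntax)
open import Data.Sum using (_⊎_; inj₁; inj₂)
open import Function using (_∘_)
open import Relation.Nullary using (¬_; Dec; yes; no)
open import Relation.Nullary.Decidable using (map′)
open import Relation.Unary using (Pred; Decidable)
open import Relation.Binary.PropositionalEquality
  using (_≡_; refl; sym; trans; cong; subst; module ≡-Reasoning)

first-crossing : ∀ {p} {P : Pred ℕ p} → Decidable P → ¬ P 0 →
                 ∀ {m} → P m → ∃[ k ] ¬ P k × P (suc k)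
first-crossing P? ¬P0 {zero}  P0   = ⊥-elim (¬P0 P0)
first-crossing P? ¬P0 {suc m} Psm with P? m
... | yes Pm  = first-crossing P? ¬P0 Pm
... | no  ¬Pm = m , ¬Pm , Psm

module _ {G : Digraph} where
  open Digraph G

  infixr 5 _◅◅_
  _◅◅_ : ∀ {u v w} → Walk G u v → Walk G v w → Walk G u w
  here     ◅◅ q = q
  step e p ◅◅ q = step e (p ◅◅ q)

  walk-into-source : ∀ {u v} → Source G v → Walk G u v → u ≡ v
  walk-into-source src here       = refl
  walk-into-source src (step e p) =
    ⊥-elim (src _ (subst (E _) (walk-into-source src p) e))

  last-arc : ∀ {u v} → Walk G u v → ¬ u ≡ v → ∃[ w ] Walk G u w × E w v
  last-arc here       u≢u = ⊥-elim (u≢u refl)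
  last-arc (step e p) _   = go e p
    where
    go : ∀ {u m v} → E u m → Walk G m v → ∃[ w ] Walk G u w × E w v
    go e here       = _ , here , e
    go e (step f p) = let w , q , g = go f p in w , step e q , g

  walk-antisym : Acyclic G → ∀ {u v} → Walk G u v → Walk G v u → u ≡ v
  walk-antisym acyclic here       q = refl
  walk-antisym acyclic (step e p) q = ⊥-elim (acyclic _ _ e (p ◅◅ q))

  Functional : Set
  Functional = ∀ {u v w} → E u v → E u w → v ≡ w

  module _ (functional : Functional) where

    walks-comparable : ∀ {a u v} → Walk G a u → Walk G a v → Walk G u v ⊎ Walk G v u
    walks-comparable here           q          = inj₁ q
    walks-comparable p@(step _ _)   here       = inj₂ p
    walks-comparable (step e p)     (step f q) with functional e f
    ... | refl = walks-comparable p q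

    walk-before-or-after : ∀ {a u x z} → Walk G a u → E u x → Walk G a z →
                           Walk G z u ⊎ Walk G x z
    walk-before-or-after a⇝u e a⇝z with walks-comparable a⇝u a⇝z
    ... | inj₂ z⇝u          = inj₁ z⇝u
    ... | inj₁ here         = inj₁ here
    ... | inj₁ (step f u⇝z) = inj₂ (subst (λ y → Walk G y _) (functional f e) u⇝z)

    separator-below-common : ∀ {a b y z} → Separates G a b y →
                             Walk G a z → Walk G b z → Walk G y z
    separator-below-common (_ , _ , ea , _ , ((_ , a⇝ua) , b↛ua) , ((pb , _) , _)) a⇝z b⇝z
      with walk-before-or-after a⇝ua ea a⇝z
    ... | inj₁ z⇝ua = ⊥-elim (b↛ua (pb , b⇝z ◅◅ z⇝ua))
    ... | inj₂ y⇝z  = y⇝z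

    separator-unique : Acyclic G → ∀ {a b x y} →
                       Separates G a b x → Separates G a b y → x ≡ y
    separator-unique acyclic sx sy =
      walk-antisym acyclic (separator-below-common sx (reached-from-a sy) (reached-from-b sy))
                           (separator-below-common sy (reached-from-a sx) (reached-from-b sx))
      where
      reached-from-a : ∀ {a b z} → Separates G a b z → Walk G a z
      reached-from-a (_ , _ , ea , _ , ((_ , a⇝ua) , _) , _) = a⇝ua ◅◅ step ea here
      reached-from-b : ∀ {a b z} → Separates G a b z → Walk G b z
      reached-from-b (_ , _ , _ , eb , _ , ((_ , b⇝ub) , _)) = b⇝ub ◅◅ step eb here

    entry-separates : Acyclic G → ∀ {a b u x} → Player G a → Player G b →
                      Walk G a u → ¬ Walk G b u → E u x → Walk G b x → Separates G a b x
    entry-separates acyclic {a} {b} {u} {x} pa pb a⇝u b↛u e b⇝x =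
      let w , b⇝w , f = last-arc b⇝x (λ { refl → pb u e })
      in  u , w , e , f , ((pa , a⇝u) , b↛u ∘ proj₂) , ((pb , b⇝w) , a↛w b⇝w f ∘ proj₂)
      where
      a↛w : ∀ {w} → Walk G b w → E w x → ¬ Walk G a w
      a↛w {w} b⇝w f a⇝w with walk-before-or-after a⇝u e a⇝w
      ... | inj₁ w⇝u = b↛u (b⇝w ◅◅ w⇝u)
      ... | inj₂ x⇝w = acyclic w x f x⇝w

module SingleElimination (T : Digraph) (S : IsSET T) where
  open Digraph T
  open IsSET S

  sink : Vertex T
  sink = proj₁ uniqueSink

  sink-isSink : Sink T sink
  sink-isSink = proj₁ (proj₂ uniqueSink)

  only-sink : ∀ v → Sink T v → v ≡ sink
  only-sink = proj₂ (proj₂ uniqueSink)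

  functional : Functional {T}
  functional {u} e f = trans (unique _ e) (sym (unique _ f))
    where unique = proj₂ (proj₂ (outDeg u (λ u-sink → u-sink _ e)))

  next : Vertex T → Vertex T
  next v with v ≟ sink
  ... | yes _      = v
  ... | no  v≢sink = proj₁ (outDeg v (v≢sink ∘ only-sink v))

  next-sink : next sink ≡ sink
  next-sink with sink ≟ sink
  ... | yes _        = refl
  ... | no sink≢sink = ⊥-elim (sink≢sink refl)

  arc-next : ∀ {v} → ¬ v ≡ sink → E v (next v)
  arc-next {v} v≢sink with v ≟ sink
  ... | yes v≡sink = ⊥-elim (v≢sink v≡sink)
  ... | no  v≢sink = proj₁ (proj₂ (outDeg v (v≢sink ∘ only-sink v)))

  arc⇒next : ∀ {u v} → E u v → v ≡ next u
  arc⇒next {u} e = functional e (arc-next u≢sink)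
    where
    u≢sink : ¬ u ≡ sink
    u≢sink refl = sink-isSink _ e

  walk-next : ∀ v → Walk T v (next v)
  walk-next v with v ≟ sink | arc-next {v}
  ... | yes _      | _   = here
  ... | no  v≢sink | arc = step (arc v≢sink) here

  next^ : ℕ → Vertex T → Vertex T
  next^ k v = fold v next k

  next^-sink : ∀ k → next^ k sink ≡ sink
  next^-sink zero    = refl
  next^-sink (suc k) = trans (cong next (next^-sink k)) next-sink

  walk-next^ : ∀ k v → Walk T v (next^ k v)
  walk-next^ zero    v = here
  walk-next^ (suc k) v = walk-next^ k v ◅◅ walk-next (next^ k v)

  walk⇒next^ : ∀ {u v} → Walk T u v → ∃[ k ] next^ k u ≡ v
  walk⇒next^ here = 0 , refl
  walk⇒next^ {u} (step e p) =
    let k , eq = walk⇒next^ p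
    in  k + 1 , trans (fold-+ u next k {1}) (trans (cong (next^ k) (sym (arc⇒next e))) eq)

  next^-stays-at-sink : ∀ {k m v} → next^ k v ≡ sink → k ≤ m → next^ m v ≡ sink
  next^-stays-at-sink {k} {m} {v} eq k≤m = begin
    next^ m v                   ≡⟨ cong (λ j → next^ j v) (sym (m∸n+n≡m k≤m)) ⟩
    next^ (m ∸ k + k) v         ≡⟨ fold-+ v next (m ∸ k) ⟩
    next^ (m ∸ k) (next^ k v)   ≡⟨ cong (next^ (m ∸ k)) eq ⟩
    next^ (m ∸ k) sink          ≡⟨ next^-sink (m ∸ k) ⟩
    sink                        ∎
    where open ≡-Reasoning

  next^-repeat⇒sink : ∀ {i j} v → i < j → next^ i v ≡ next^ j v → next^ i v ≡ sink
  next^-repeat⇒sink {i} {j} v i<j eq with next^ i v ≟ sink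
  ... | yes w≡sink = w≡sink
  ... | no  w≢sink = ⊥-elim (acyclic w (next w) (arc-next w≢sink) back)
    where
    w = next^ i v
    d = j ∸ suc i
    back : Walk T (next w) w
    back = subst (Walk T (next w)) (begin
      next^ d (next w)     ≡⟨ fold-+ v next d ⟨
      next^ (d + suc i) v  ≡⟨ cong (λ j′ → next^ j′ v) (m∸n+n≡m i<j) ⟩
      next^ j v            ≡⟨ eq ⟨
      w                    ∎) (walk-next^ d (next w))
      where open ≡-Reasoning

  next^n≡sink : ∀ v → next^ n v ≡ sink
  next^n≡sink v =
    let i , j , i<j , eq = pigeonhole (n<1+n n) (λ i → next^ (toℕ i) v)
    in  next^-stays-at-sink (next^-repeat⇒sink v i<j eq) (toℕ≤pred[n] i)

  next^-bounded : ∀ {u v} → ∃[ k ] next^ k u ≡ v → ∃[ i ] next^ (toℕ {suc n} i) u ≡ v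
  next^-bounded {u} (k , eq) with k ≤? n
  ... | yes k≤n = fromℕ< (s≤s k≤n) , trans (cong (λ j → next^ j u) (toℕ-fromℕ< (s≤s k≤n))) eq
  ... | no  k≰n = fromℕ n , (begin
    next^ (toℕ (fromℕ n)) u   ≡⟨ cong (λ j → next^ j u) (toℕ-fromℕ n) ⟩
    next^ n u                 ≡⟨ next^n≡sink u ⟩
    sink                      ≡⟨ next^-stays-at-sink (next^n≡sink u) (≰⇒≥ k≰n) ⟨
    next^ k u                 ≡⟨ eq ⟩
    _                         ∎)
    where open ≡-Reasoning

  walk? : ∀ u v → Dec (Walk T u v)
  walk? u v = map′ (λ (i , eq) → subst (Walk T u) eq (walk-next^ (toℕ i) u))
                   (next^-bounded ∘ walk⇒next^)
                   (any? (λ i → next^ (toℕ i) u ≟ v))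

  crossing-arc : ∀ {b u} → ¬ Walk T b u → Walk T b (next u) → E u (next u)
  crossing-arc {b} {u} b↛u b⇝next = arc-next u≢sink
    where
    u≢sink : ¬ u ≡ sink
    u≢sink refl = b↛u (subst (Walk T b) next-sink b⇝next)

  separator-exists : ∀ {a b} → Player T a → Player T b → ¬ a ≡ b →
                     ∃[ x ] Match T x × Separates T a b x
  separator-exists {a} {b} pa pb a≢b =
    let k , b↛u , b⇝x = first-crossing (λ k → walk? b (next^ k a)) b↛a {n} b⇝end
        e             = crossing-arc b↛u b⇝x
    in  next^ (suc k) a , (λ src → src _ e)
      , entry-separates functional acyclic pa pb (walk-next^ k a) b↛u e b⇝x
    where
    b↛a : ¬ Walk T b a
    b↛a = a≢b ∘ sym ∘ walk-into-source pa
    b⇝end : Walk T b (next^ n a)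
    b⇝end = subst (Walk T b) (trans (next^n≡sink b) (sym (next^n≡sink a))) (walk-next^ n b)

lemma4p2 : (T : Digraph) → IsSET T → (a b : Vertex T) → Player T a → Player T b → ¬ a ≡ b → Σ (Vertex T) (λ x → (Match T x × Separates T a b x) × (∀ y → Match T y → Separates T a b y → y ≡ x))
lemma4p2 T S a b pa pb a≢b =
  let x , match , sep = separator-exists pa pb a≢b
  in  x , (match , sep) , λ y _ sep′ → separator-unique functional acyclic sep′ sep
  where
  open SingleElimination T S
  open IsSET S using (acyclic)
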